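{- The group $\mathbb{Z}_2^3$ cannot be realized by a 3-net in $\mathbb{P}^2$.
   Context: A 3-net in $\mathbb{P}^2$ is a pair $(\mathcal{A},\mathcal{X})$ where $\mathcal{A}$ is a finite set of lines in the complex projective plane partitioned into 3 classes $\mathcal{A}=\mathcal{A}_1\cup\mathcal{A}_2\cup\mathcal{A}_3$ and $\mathcal{X}$ is a finite set of points such that: (i) for every $i\neq j$ and every $l\in\mathcal{A}_i$, $l'\in\mathcal{A}_j$, $l\cap l'\in\mathcal{X}$; (ii) for every $X\in\mathcal{X}$ and every $i$ there is a unique $l\in\mathcal{A}_i$ through $X$. A 3-net realizes a group $H$ if there are bijections $\phi_i:H\to\mathcal{A}_i$ ($i=1,2,3$) such that for all $a,b\in H$ the line $\phi_3(ab)$ passes through the point $\phi_1(a)\cap\phi_2(b)$. -}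

module Defs where

open import Level using (Level; _⊔_; suc)
open import Data.Nat using (ℕ; zero) renaming (suc to sucℕ)
open import Data.Bool using (Bool; true; false; _xor_)
open import Data.Fin using (Fin) renaming (zero to f0; suc to fs)
open import Data.List using (List; []; _∷_; _++_; [_])
open import Data.List.Relation.Unary.Any using (Any)
open import Data.Product using (Σ; ∃; _×_; _,_; ∃-syntax)
open import Relation.Nullary using (¬_)
open import Relation.Binary.PropositionalEquality using (_≡_; _≢_)
open import Algebra.Bundles using (CommutativeRing)

record Field (c ℓ : Level) : Set (Level.suc (c ⊔ ℓ)) where
  field
    commRing : CommutativeRing c ℓ
  open CommutativeRing commRing public
  field
    1≉0     : ¬ (1# ≈ 0#)
    inverse : ∀ x → ¬ (x ≈ 0#) → ∃[ y ] (x * y ≈ 1#)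

  fromℕ : ℕ → Carrier
  fromℕ zero     = 0#
  fromℕ (sucℕ n) = 1# + fromℕ n

  eval : List Carrier → Carrier → Carrier
  eval []       x = 0#
  eval (c ∷ cs) x = c + x * eval cs x

CharZero : ∀ {c ℓ} → Field c ℓ → Set ℓ
CharZero K = ∀ n → ¬ (fromℕ (sucℕ n) ≈ 0#)
  where open Field K

-- algebraically closed: every monic polynomial of degree ≥ 1
-- (coefficients c ∷ cs followed by leading coefficient 1) has a root
AlgClosed : ∀ {c ℓ} → Field c ℓ → Set (c ⊔ ℓ)
AlgClosed K = ∀ (c : Carrier) (cs : List Carrier) →
              ∃[ x ] (eval ((c ∷ cs) ++ [ 1# ]) x ≈ 0#)
  where open Field K

-- The projective plane P²(K): points and lines are nonzero triples up to
-- scaling (homogeneous coordinates, resp. coefficients of a linear form).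

module ProjectivePlane {c ℓ} (K : Field c ℓ) where
  open Field K hiding (zero)

  record Triple : Set c where
    constructor ⟨_,_,_⟩
    field x y z : Carrier
  open Triple public

  Zero : Triple → Set ℓ
  Zero v = (x v ≈ 0#) × (y v ≈ 0#) × (z v ≈ 0#)

  record Proj : Set (c ⊔ ℓ) where
    constructor proj
    field
      coords  : Triple
      nonzero : ¬ Zero coords
  open Proj public

  Point : Set (c ⊔ ℓ)
  Point = Proj

  Line : Set (c ⊔ ℓ)
  Line = Proj

  -- equality in P²: the two triples are proportional, i.e. all 2×2
  -- minors vanish (cross product is zero)
  _∼_ : Proj → Proj → Set ℓ
  P ∼ Q = (y p * z q ≈ z p * y q) × (z p * x q ≈ x p * z q) × (x p * y q ≈ y p * x q)
    where p = coords P ; q = coords Q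

  _on_ : Point → Line → Set ℓ
  P on L = x p * x l + y p * y l + z p * z l ≈ 0#
    where p = coords P ; l = coords L

  _∈ₚ_ : Point → List Point → Set (c ⊔ ℓ)
  P ∈ₚ 𝒳 = Any (λ Q → P ∼ Q) 𝒳

  -- A 3-net realizing a group with carrier H and operation _·_.
  -- The classes are 𝒜ᵢ = image of φ i (i ∈ Fin 3), with φ i : H → 𝒜ᵢ a
  -- bijection; 𝒳 is a finite set of points.

  record Realizes3Net {h} (H : Set h) (_·_ : H → H → H) : Set (c ⊔ ℓ ⊔ h) where
    field
      φ : Fin 3 → H → Line
      𝒳 : List Point
      φ-injective : ∀ i a b → φ i a ∼ φ i b → a ≡ b
      classes-disjoint : ∀ i j → i ≢ j → ∀ a b → ¬ (φ i a ∼ φ j b)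
      net-i  : ∀ i j → i ≢ j → ∀ a b →
               ∃[ X ] (X ∈ₚ 𝒳 × X on φ i a × X on φ j b)
      net-ii-exists : ∀ X → X ∈ₚ 𝒳 → ∀ i → ∃[ a ] (X on φ i a)
      net-ii-unique : ∀ X → X ∈ₚ 𝒳 → ∀ i a b → X on φ i a → X on φ i b → a ≡ b
      realizes : ∀ a b X → X on φ f0 a → X on φ (fs f0) b →
                 X on φ (fs (fs f0)) (a · b)

ℤ₂³ : Set
ℤ₂³ = Bool × Bool × Bool

_⊕_ : ℤ₂³ → ℤ₂³ → ℤ₂³
(a₁ , a₂ , a₃) ⊕ (b₁ , b₂ , b₃) = (a₁ xor b₁ , a₂ xor b₂ , a₃ xor b₃)

-- Write A g, B g, C g for the lines of the three classes, e₁ = (1,0,0), and [l m n] for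
-- the determinant of three lines. Let p, q lie in different cosets of {0, e₁} and r = p + q.
-- The line C p contains A 0 ∩ B p, A e₁ ∩ B (p + e₁) and A r ∩ B q, so A r passes through
-- the point where the line joining the first two meets B q; likewise for C q and
-- C (q + e₁). These three points of A r are collinear, and their determinant factors into
-- three brackets that do not vanish in a 3-net and α p β q + α q β p, where
-- α g = [A 0, B g, B (g + e₁)] and β g = [A e₁, B g, B (g + e₁)]. So the lines joining
-- A 0 ∩ A e₁ to B g ∩ B (g + e₁), for g = 0, e₂, e₃, are pairwise harmonic with respect
-- to A 0 and A e₁, which is impossible when 2 ≠ 0.

module Submission where

open import Algebra.Bundles using (CommutativeRing; RawRing)
open import Data.Bool.Base using (Bool; true; false; _xor_)
open import Data.Bool.Properties using (xor-comm; xor-assoc; xor-same; xor-identityʳ)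
open import Data.Fin.Base using (Fin; zero; suc)
open import Data.Maybe.Base using (nothing)
open import Data.Nat.Base as ℕ using (ℕ; zero; suc)
import Data.Nat.Properties as ℕ
open import Data.Empty using (⊥)
open import Data.Product.Base using (_×_; _,_)
open import Data.Vec.Base using (Vec)
open import Data.Vec.N-ary using (N-ary)
open import Effect.Monad using (RawMonad)
open import Relation.Binary.PropositionalEquality as ≡ using (_≡_; _≢_; cong; cong₂)
open import Relation.Nullary.Negation using (¬_; ¬¬-Monad)
open import Tactic.RingSolver.Core.AlmostCommutativeRing using (fromCommutativeRing)
open import Tactic.RingSolver.Core.Expression
  using (Expr; Κ; Ι; module Eval)
  renaming (_⊕_ to _:+_; _⊗_ to _:*_; ⊝_ to :-_; _⊛_ to _:^_)
open import Tactic.RingSolver.Core.Polynomial.Parameters using (Homomorphism)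
open import Defs

-- Tactic.RingSolver.NonReflective uses the carrier itself as coefficients; since equality
-- in R is undecidable it cannot cancel x - x. So the polynomial normaliser of
-- Tactic.RingSolver is instantiated here with integer coefficients instead.
module IntegerRingSolver {c ℓ} (R : CommutativeRing c ℓ) where
  open CommutativeRing R hiding (zero)
  open import Relation.Binary.Reasoning.Setoid setoid
  open import Algebra.Properties.Semiring.Mult.TCOptimised semiring
    using (1+×; ×-homo-+; ×1-homo-*) renaming (_×_ to _·_)
  open import Algebra.Properties.Ring ring using ([y-z]x≈yx-zx; x[y-z]≈xy-xz)
  open import Algebra.Properties.Group +-group using (ε⁻¹≈ε)
  open import Algebra.Properties.AbelianGroup +-abelianGroup using (⁻¹-anti-homo‿-; ⁻¹-∙-comm)
  open import Algebra.Properties.CommutativeSemigroup +-commutativeSemigroup using (interchange)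

  -- The integer m − n is coded as (m , n); `reduce` keeps one side 0, so that
  -- equal integers have equal codes, as the solver's normal forms require.
  Diff : Set
  Diff = ℕ × ℕ

  reduce : ℕ → ℕ → Diff
  reduce (suc m) (suc n) = reduce m n
  reduce m       n       = m , n

  Diff-rawRing : RawRing _ _
  Diff-rawRing = record
    { Carrier = Diff ; _≈_ = _≡_
    ; _+_ = λ (m , n) (m′ , n′) → reduce (m ℕ.+ m′) (n ℕ.+ n′)
    ; _*_ = λ (m , n) (m′ , n′) → reduce (m ℕ.* m′ ℕ.+ n ℕ.* n′) (m ℕ.* n′ ℕ.+ n ℕ.* m′)
    ; -_  = λ (m , n) → n , m
    ; 0#  = 0 , 0
    ; 1#  = 1 , 0
    }

  -- Split on n so that the constants 0 and 1 of an equation denote 0# and 1# on the nose.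
  ⟦_⟧ᶜ : Diff → Carrier
  ⟦ m , zero  ⟧ᶜ = m · 1#
  ⟦ m , suc n ⟧ᶜ = m · 1# - suc n · 1#

  ⟦⟧ᶜ-sound : ∀ m n → ⟦ m , n ⟧ᶜ ≈ m · 1# - n · 1#
  ⟦⟧ᶜ-sound m zero    = sym (trans (+-congˡ ε⁻¹≈ε) (+-identityʳ (m · 1#)))
  ⟦⟧ᶜ-sound m (suc n) = refl

  sum-difference : ∀ a b c d → (a + b) - (c + d) ≈ (a - c) + (b - d)
  sum-difference a b c d = begin
    (a + b) - (c + d)       ≈⟨ +-congˡ (⁻¹-∙-comm c d) ⟨
    (a + b) + (- c + - d)   ≈⟨ interchange a b (- c) (- d) ⟩
    (a - c) + (b - d)       ∎

  product-difference : ∀ a b c d → (a - b) * (c - d) ≈ (a * c + b * d) - (a * d + b * c)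
  product-difference a b c d = begin
    (a - b) * (c - d)                   ≈⟨ [y-z]x≈yx-zx (c - d) a b ⟩
    a * (c - d) - b * (c - d)           ≈⟨ +-cong (x[y-z]≈xy-xz a c d) (-‿cong (x[y-z]≈xy-xz b c d)) ⟩
    (a * c - a * d) - (b * c - b * d)   ≈⟨ +-congˡ (⁻¹-anti-homo‿- (b * c) (b * d)) ⟩
    (a * c - a * d) + (b * d - b * c)   ≈⟨ sum-difference _ _ _ _ ⟨
    (a * c + b * d) - (a * d + b * c)   ∎

  reduce-sound : ∀ m n → ⟦ reduce m n ⟧ᶜ ≈ m · 1# - n · 1#
  reduce-sound (suc m) (suc n) = begin
    ⟦ reduce m n ⟧ᶜ                      ≈⟨ reduce-sound m n ⟩
    m · 1# - n · 1#                      ≈⟨ +-identityˡ _ ⟨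
    0# + (m · 1# - n · 1#)               ≈⟨ +-congʳ (-‿inverseʳ 1#) ⟨
    (1# - 1#) + (m · 1# - n · 1#)        ≈⟨ sum-difference 1# (m · 1#) 1# (n · 1#) ⟨
    (1# + m · 1#) - (1# + n · 1#)        ≈⟨ +-cong (1+× m 1#) (-‿cong (1+× n 1#)) ⟨
    suc m · 1# - suc n · 1#              ∎
  reduce-sound zero    n    = ⟦⟧ᶜ-sound zero n
  reduce-sound (suc m) zero = ⟦⟧ᶜ-sound (suc m) zero

  +-homo : ∀ i j → ⟦ RawRing._+_ Diff-rawRing i j ⟧ᶜ ≈ ⟦ i ⟧ᶜ + ⟦ j ⟧ᶜ
  +-homo (m , n) (m′ , n′) = begin
    ⟦ reduce (m ℕ.+ m′) (n ℕ.+ n′) ⟧ᶜ          ≈⟨ reduce-sound (m ℕ.+ m′) (n ℕ.+ n′) ⟩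
    (m ℕ.+ m′) · 1# - (n ℕ.+ n′) · 1#          ≈⟨ +-cong (×-homo-+ 1# m m′) (-‿cong (×-homo-+ 1# n n′)) ⟩
    (m · 1# + m′ · 1#) - (n · 1# + n′ · 1#)    ≈⟨ sum-difference _ _ _ _ ⟩
    (m · 1# - n · 1#) + (m′ · 1# - n′ · 1#)    ≈⟨ +-cong (⟦⟧ᶜ-sound m n) (⟦⟧ᶜ-sound m′ n′) ⟨
    ⟦ m , n ⟧ᶜ + ⟦ m′ , n′ ⟧ᶜ                  ∎

  *-homo : ∀ i j → ⟦ RawRing._*_ Diff-rawRing i j ⟧ᶜ ≈ ⟦ i ⟧ᶜ * ⟦ j ⟧ᶜ
  *-homo (m , n) (m′ , n′) = begin
    ⟦ reduce (m ℕ.* m′ ℕ.+ n ℕ.* n′) (m ℕ.* n′ ℕ.+ n ℕ.* m′) ⟧ᶜ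
      ≈⟨ reduce-sound (m ℕ.* m′ ℕ.+ n ℕ.* n′) (m ℕ.* n′ ℕ.+ n ℕ.* m′) ⟩
    (m ℕ.* m′ ℕ.+ n ℕ.* n′) · 1# - (m ℕ.* n′ ℕ.+ n ℕ.* m′) · 1#
      ≈⟨ +-cong (expand m m′ n n′) (-‿cong (expand m n′ n m′)) ⟩
    (m · 1# * m′ · 1# + n · 1# * n′ · 1#) - (m · 1# * n′ · 1# + n · 1# * m′ · 1#)
      ≈⟨ product-difference _ _ _ _ ⟨
    (m · 1# - n · 1#) * (m′ · 1# - n′ · 1#)
      ≈⟨ *-cong (⟦⟧ᶜ-sound m n) (⟦⟧ᶜ-sound m′ n′) ⟨
    ⟦ m , n ⟧ᶜ * ⟦ m′ , n′ ⟧ᶜ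
      ∎
    where
    expand : ∀ a b c d → (a ℕ.* b ℕ.+ c ℕ.* d) · 1# ≈ a · 1# * b · 1# + c · 1# * d · 1#
    expand a b c d = trans (×-homo-+ 1# (a ℕ.* b) (c ℕ.* d)) (+-cong (×1-homo-* a b) (×1-homo-* c d))

  -‿homo : ∀ i → ⟦ RawRing.-_ Diff-rawRing i ⟧ᶜ ≈ - ⟦ i ⟧ᶜ
  -‿homo (m , n) = begin
    ⟦ n , m ⟧ᶜ           ≈⟨ ⟦⟧ᶜ-sound n m ⟩
    n · 1# - m · 1#      ≈⟨ ⁻¹-anti-homo‿- (m · 1#) (n · 1#) ⟨
    - (m · 1# - n · 1#)  ≈⟨ -‿cong (⟦⟧ᶜ-sound m n) ⟨
    - ⟦ m , n ⟧ᶜ         ∎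

  zero-sound : ∀ m n → m ≡ n → 0# ≈ ⟦ m , n ⟧ᶜ
  zero-sound m .m ≡.refl = sym (trans (⟦⟧ᶜ-sound m m) (-‿inverseʳ (m · 1#)))

  homomorphism : Homomorphism _ _ c ℓ
  homomorphism = record
    { from = record { rawRing = Diff-rawRing ; isZero = λ (m , n) → m ℕ.≡ᵇ n }
    ; to = fromCommutativeRing R (λ _ → nothing)
    ; morphism = record
      { ⟦_⟧ = ⟦_⟧ᶜ ; +-homo = +-homo ; *-homo = *-homo ; -‿homo = -‿homo
      ; 0-homo = refl ; 1-homo = refl
      }
    ; Zero-C⟶Zero-R = λ (m , n) m≡ᵇn → zero-sound m n (ℕ.≡ᵇ⇒≡ m n m≡ᵇn)
    }

  open Eval rawRing ⟦_⟧ᶜ using (⟦_⟧)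
  open import Tactic.RingSolver.Core.Polynomial.Base (Homomorphism.from homomorphism)
  open import Tactic.RingSolver.Core.Polynomial.Semantics homomorphism renaming (⟦_⟧ to ⟦_⟧ₚ)
  open import Tactic.RingSolver.Core.Polynomial.Homomorphism homomorphism
  open import Algebra.Properties.Semiring.Exp.TCOptimised semiring using (^-congˡ)

  normalise : ∀ {n} → Expr Diff n → Poly n
  normalise (Κ i)    = κ i
  normalise (Ι i)    = ι i
  normalise (e :+ f) = normalise e ⊞ normalise f
  normalise (e :* f) = normalise e ⊠ normalise f
  normalise (:- e)   = ⊟ normalise e
  normalise (e :^ k) = normalise e ⊡ k

  ⟦_⇓⟧ : ∀ {n} → Expr Diff n → Vec Carrier n → Carrier
  ⟦ e ⇓⟧ = ⟦ normalise e ⟧ₚ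

  normalise-sound : ∀ {n} (e : Expr Diff n) ρ → ⟦ e ⇓⟧ ρ ≈ ⟦ e ⟧ ρ
  normalise-sound (Κ i)    ρ = κ-hom i ρ
  normalise-sound (Ι i)    ρ = ι-hom i ρ
  normalise-sound (e :+ f) ρ =
    trans (⊞-hom (normalise e) (normalise f) ρ) (+-cong (normalise-sound e ρ) (normalise-sound f ρ))
  normalise-sound (e :* f) ρ =
    trans (⊠-hom (normalise e) (normalise f) ρ) (*-cong (normalise-sound e ρ) (normalise-sound f ρ))
  normalise-sound (:- e)   ρ = trans (⊟-hom (normalise e) ρ) (-‿cong (normalise-sound e ρ))
  normalise-sound (e :^ k) ρ = trans (⊡-hom (normalise e) k ρ) (^-congˡ k (normalise-sound e ρ))

  open import Relation.Binary.Reflection setoid Ι ⟦_⟧ ⟦_⇓⟧ normalise-sound public using (solve; _⊜_)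

  exprRawRing : ℕ → RawRing _ _
  exprRawRing n = record
    { Carrier = Expr Diff n ; _≈_ = _≡_
    ; _+_ = _:+_ ; _*_ = _:*_ ; -_ = :-_ ; 0# = Κ (0 , 0) ; 1# = Κ (1 , 0)
    }

module Vector3 {c ℓ} (R : RawRing c ℓ) where
  open RawRing R

  private
    infixl 6 _-_
    _-_ : Carrier → Carrier → Carrier
    a - b = a + - b

  record V : Set c where
    constructor v
    field x y z : Carrier
  open V public

  coord : V → Fin 3 → Carrier
  coord p zero             = x p
  coord p (suc zero)       = y p
  coord p (suc (suc zero)) = z p

  dot : V → V → Carrier
  dot p q = x p * x q + y p * y q + z p * z q

  cross : V → V → V
  cross p q = v (y p * z q - z p * y q) (z p * x q - x p * z q) (x p * y q - y p * x q)

  det : V → V → V → Carrier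
  det p q r = dot p (cross q r)

  -- For points p, q and a line l: the point where the line pq meets l.
  meet : V → V → V → V
  meet p q l = v (dot q l * x p - dot p l * x q) (dot q l * y p - dot p l * y q) (dot q l * z p - dot p l * z q)

module VectorIdentities {c ℓ} (R : CommutativeRing c ℓ) where
  open CommutativeRing R hiding (zero)
  open IntegerRingSolver R
  open Vector3 rawRing public
  private module E {n} = Vector3 (exprRawRing n)

  dot-comm : ∀ p q → dot p q ≈ dot q p
  dot-comm (v p₁ p₂ p₃) (v q₁ q₂ q₃) =
    solve 6 (λ p₁ p₂ p₃ q₁ q₂ q₃ →
      E.dot (E.v p₁ p₂ p₃) (E.v q₁ q₂ q₃) ⊜ E.dot (E.v q₁ q₂ q₃) (E.v p₁ p₂ p₃))
      refl p₁ p₂ p₃ q₁ q₂ q₃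

  dot-crossˡ : ∀ p q → dot (cross p q) p ≈ 0#
  dot-crossˡ (v p₁ p₂ p₃) (v q₁ q₂ q₃) =
    solve 6 (λ p₁ p₂ p₃ q₁ q₂ q₃ →
      E.dot (E.cross (E.v p₁ p₂ p₃) (E.v q₁ q₂ q₃)) (E.v p₁ p₂ p₃) ⊜ Κ (0 , 0))
      refl p₁ p₂ p₃ q₁ q₂ q₃

  dot-crossʳ : ∀ p q → dot (cross p q) q ≈ 0#
  dot-crossʳ (v p₁ p₂ p₃) (v q₁ q₂ q₃) =
    solve 6 (λ p₁ p₂ p₃ q₁ q₂ q₃ →
      E.dot (E.cross (E.v p₁ p₂ p₃) (E.v q₁ q₂ q₃)) (E.v q₁ q₂ q₃) ⊜ Κ (0 , 0))
      refl p₁ p₂ p₃ q₁ q₂ q₃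

  det-rotate : ∀ p q r → det p q r ≈ det r p q
  det-rotate (v p₁ p₂ p₃) (v q₁ q₂ q₃) (v r₁ r₂ r₃) =
    solve 9 (λ p₁ p₂ p₃ q₁ q₂ q₃ r₁ r₂ r₃ →
      let p = E.v p₁ p₂ p₃ ; q = E.v q₁ q₂ q₃ ; r = E.v r₁ r₂ r₃
      in E.det p q r ⊜ E.det r p q)
      refl p₁ p₂ p₃ q₁ q₂ q₃ r₁ r₂ r₃

  private
    det-expansion-equation : Fin 3 → N-ary 12 (Expr Diff 12) (Expr Diff 12 × Expr Diff 12)
    det-expansion-equation i p₁ p₂ p₃ q₁ q₂ q₃ r₁ r₂ r₃ s₁ s₂ s₃ =
      let p = E.v p₁ p₂ p₃ ; q = E.v q₁ q₂ q₃ ; r = E.v r₁ r₂ r₃ ; s = E.v s₁ s₂ s₃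
      in E.coord s i :* E.det p q r
         ⊜ E.coord (E.cross q r) i :* E.dot p s :+ E.coord (E.cross r p) i :* E.dot q s
           :+ E.coord (E.cross p q) i :* E.dot r s

  -- Cramer's rule: s expanded in the basis dual to p, q, r.
  det-expansion : ∀ i p q r s →
    coord s i * det p q r ≈
      coord (cross q r) i * dot p s + coord (cross r p) i * dot q s + coord (cross p q) i * dot r s
  det-expansion zero (v p₁ p₂ p₃) (v q₁ q₂ q₃) (v r₁ r₂ r₃) (v s₁ s₂ s₃) =
    solve 12 (det-expansion-equation zero) refl p₁ p₂ p₃ q₁ q₂ q₃ r₁ r₂ r₃ s₁ s₂ s₃
  det-expansion (suc zero) (v p₁ p₂ p₃) (v q₁ q₂ q₃) (v r₁ r₂ r₃) (v s₁ s₂ s₃) =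
    solve 12 (det-expansion-equation (suc zero)) refl p₁ p₂ p₃ q₁ q₂ q₃ r₁ r₂ r₃ s₁ s₂ s₃
  det-expansion (suc (suc zero)) (v p₁ p₂ p₃) (v q₁ q₂ q₃) (v r₁ r₂ r₃) (v s₁ s₂ s₃) =
    solve 12 (det-expansion-equation (suc (suc zero))) refl p₁ p₂ p₃ q₁ q₂ q₃ r₁ r₂ r₃ s₁ s₂ s₃

  -- The line a passes through the point where pq meets b iff a ∩ b lies on pq.
  det-cross≈dot-meet : ∀ p q a b → det p q (cross a b) ≈ dot (meet p q b) a
  det-cross≈dot-meet (v p₁ p₂ p₃) (v q₁ q₂ q₃) (v a₁ a₂ a₃) (v b₁ b₂ b₃) =
    solve 12 (λ p₁ p₂ p₃ q₁ q₂ q₃ a₁ a₂ a₃ b₁ b₂ b₃ →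
      let p = E.v p₁ p₂ p₃ ; q = E.v q₁ q₂ q₃ ; a = E.v a₁ a₂ a₃ ; b = E.v b₁ b₂ b₃
      in E.det p q (E.cross a b) ⊜ E.dot (E.meet p q b) a)
      refl p₁ p₂ p₃ q₁ q₂ q₃ a₁ a₂ a₃ b₁ b₂ b₃

  det-meets : ∀ a a′ b b′ c c′ →
    det (meet (cross a b)  (cross a′ b′) c)
        (meet (cross a c)  (cross a′ c′) b)
        (meet (cross a c′) (cross a′ c)  b′)
    ≈ det a b c * det a′ a c′ * det a′ b′ c * (det a b b′ * det a′ c c′ + det a c c′ * det a′ b b′)
  det-meets (v a₁ a₂ a₃) (v a₁′ a₂′ a₃′) (v b₁ b₂ b₃) (v b₁′ b₂′ b₃′) (v c₁ c₂ c₃) (v c₁′ c₂′ c₃′) =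
    solve 18 (λ a₁ a₂ a₃ a₁′ a₂′ a₃′ b₁ b₂ b₃ b₁′ b₂′ b₃′ c₁ c₂ c₃ c₁′ c₂′ c₃′ →
      let a = E.v a₁ a₂ a₃ ; a′ = E.v a₁′ a₂′ a₃′ ; b = E.v b₁ b₂ b₃ ; b′ = E.v b₁′ b₂′ b₃′
          c = E.v c₁ c₂ c₃ ; c′ = E.v c₁′ c₂′ c₃′
      in E.det (E.meet (E.cross a b)  (E.cross a′ b′) c)
               (E.meet (E.cross a c)  (E.cross a′ c′) b)
               (E.meet (E.cross a c′) (E.cross a′ c)  b′)
         ⊜ E.det a b c :* E.det a′ a c′ :* E.det a′ b′ c
           :* (E.det a b b′ :* E.det a′ c c′ :+ E.det a c c′ :* E.det a′ b b′))
      refl a₁ a₂ a₃ a₁′ a₂′ a₃′ b₁ b₂ b₃ b₁′ b₂′ b₃′ c₁ c₂ c₃ c₁′ c₂′ c₃′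

module FieldGeometry {c ℓ} (K : Field c ℓ) where
  open Field K hiding (zero)
  open VectorIdentities commRing public
  open IntegerRingSolver commRing using (solve; _⊜_)
  open import Relation.Binary.Reasoning.Setoid setoid
  open import Algebra.Properties.CommutativeSemigroup *-commutativeSemigroup using (xy∙z≈y∙xz)

  NonZero : V → Set ℓ
  NonZero p = ¬ (x p ≈ 0# × y p ≈ 0# × z p ≈ 0#)

  *≈0-cancelˡ : ∀ {a b} → ¬ a ≈ 0# → a * b ≈ 0# → b ≈ 0#
  *≈0-cancelˡ {a} {b} a≉0 ab≈0 with inverse a a≉0
  ... | a⁻¹ , aa⁻¹≈1 = begin
    b              ≈⟨ *-identityˡ b ⟨
    1# * b         ≈⟨ *-congʳ aa⁻¹≈1 ⟨
    a * a⁻¹ * b    ≈⟨ xy∙z≈y∙xz a a⁻¹ b ⟩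
    a⁻¹ * (a * b)  ≈⟨ *-congˡ ab≈0 ⟩
    a⁻¹ * 0#       ≈⟨ zeroʳ a⁻¹ ⟩
    0#             ∎

  *-≉0 : ∀ {a b} → ¬ a ≈ 0# → ¬ b ≈ 0# → ¬ a * b ≈ 0#
  *-≉0 a≉0 b≉0 ab≈0 = b≉0 (*≈0-cancelˡ a≉0 ab≈0)

  annihilates-nonzero⇒≈0 : ∀ {t} w → NonZero w → (∀ i → coord w i * t ≈ 0#) → ¬ ¬ t ≈ 0#
  annihilates-nonzero⇒≈0 w w≉0 wt≈0 t≉0 =
    w≉0 (cancel zero , cancel (suc zero) , cancel (suc (suc zero)))
    where
    cancel : ∀ i → coord w i ≈ 0#
    cancel i = *≈0-cancelˡ t≉0 (trans (*-comm _ _) (wt≈0 i))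

  private
    combination≈0 : ∀ {s a b c d e f} → s ≈ a * d + b * e + c * f → d ≈ 0# → e ≈ 0# → f ≈ 0# → s ≈ 0#
    combination≈0 {s} {a} {b} {c} {d} {e} {f} s≈ d≈0 e≈0 f≈0 = begin
      s                          ≈⟨ s≈ ⟩
      a * d + b * e + c * f      ≈⟨ +-cong (+-cong (*-congˡ d≈0) (*-congˡ e≈0)) (*-congˡ f≈0) ⟩
      a * 0# + b * 0# + c * 0#   ≈⟨ +-cong (+-cong (zeroʳ a) (zeroʳ b)) (zeroʳ c) ⟩
      0# + 0# + 0#               ≈⟨ trans (+-identityʳ _) (+-identityʳ 0#) ⟩
      0#                         ∎

    last-term≈0 : ∀ {s a b c d e f} → s ≈ a * d + b * e + c * f → s ≈ 0# → d ≈ 0# → e ≈ 0# → c * f ≈ 0#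
    last-term≈0 {s} {a} {b} {c} {d} {e} {f} s≈ s≈0 d≈0 e≈0 = begin
      c * f                        ≈⟨ +-identityˡ (c * f) ⟨
      0# + c * f                   ≈⟨ +-congʳ (+-identityʳ 0#) ⟨
      0# + 0# + c * f              ≈⟨ +-congʳ (+-cong (zeroʳ a) (zeroʳ b)) ⟨
      a * 0# + b * 0# + c * f      ≈⟨ +-congʳ (+-cong (*-congˡ d≈0) (*-congˡ e≈0)) ⟨
      a * d + b * e + c * f        ≈⟨ s≈ ⟨
      s                            ≈⟨ s≈0 ⟩
      0#                           ∎

  on-line⇒det≈0 : ∀ {p q r} l → NonZero l →
    dot p l ≈ 0# → dot q l ≈ 0# → dot r l ≈ 0# → ¬ ¬ det p q r ≈ 0#
  on-line⇒det≈0 {p} {q} {r} l l≉0 pl≈0 ql≈0 rl≈0 =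
    annihilates-nonzero⇒≈0 l l≉0 (λ i → combination≈0 (det-expansion i p q r l) pl≈0 ql≈0 rl≈0)

  det≈0⇒on : ∀ {l m n} X → NonZero (cross l m) →
    dot X l ≈ 0# → dot X m ≈ 0# → det l m n ≈ 0# → ¬ ¬ dot X n ≈ 0#
  det≈0⇒on {l} {m} {n} X l×m≉0 Xl≈0 Xm≈0 lmn≈0 =
    annihilates-nonzero⇒≈0 (cross l m) l×m≉0 λ i →
      trans (*-congˡ (dot-comm X n))
        (last-term≈0 (det-expansion i l m n X) (trans (*-congˡ lmn≈0) (zeroʳ _))
          (trans (dot-comm l X) Xl≈0) (trans (dot-comm m X) Xm≈0))

  -- (a : b) and (c : d) are harmonic conjugates with respect to (1 : 0) and (0 : 1).
  Harmonic : Carrier → Carrier → Carrier → Carrier → Set ℓ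
  Harmonic a b c d = a * d + c * b ≈ 0#

  no-three-harmonic : ¬ fromℕ 2 ≈ 0# → ∀ {a₁ b₁ a₂ b₂ a₃ b₃} → ¬ b₁ ≈ 0# → ¬ a₂ ≈ 0# → ¬ b₃ ≈ 0# →
    Harmonic a₁ b₁ a₂ b₂ → Harmonic a₁ b₁ a₃ b₃ → Harmonic a₂ b₂ a₃ b₃ → ⊥
  no-three-harmonic 2≉0 {a₁} {b₁} {a₂} {b₂} {a₃} {b₃} b₁≉0 a₂≉0 b₃≉0 h₁₂ h₁₃ h₂₃ =
    *-≉0 (*-≉0 a₂≉0 b₁≉0) b₃≉0 (*≈0-cancelˡ 2≉0 (combination≈0 identity h₂₃ h₁₂ h₁₃))
    where
    identity : fromℕ 2 * (a₂ * b₁ * b₃) ≈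
      b₁ * (a₂ * b₃ + a₃ * b₂) + b₃ * (a₁ * b₂ + a₂ * b₁) + (- b₂) * (a₁ * b₃ + a₃ * b₁)
    identity = solve 6 (λ a₁ b₁ a₂ b₂ a₃ b₃ →
      (Κ (1 , 0) :+ (Κ (1 , 0) :+ Κ (0 , 0))) :* (a₂ :* b₁ :* b₃)
      ⊜ b₁ :* (a₂ :* b₃ :+ a₃ :* b₂) :+ b₃ :* (a₁ :* b₂ :+ a₂ :* b₁)
        :+ (:- b₂) :* (a₁ :* b₃ :+ a₃ :* b₁))
      refl a₁ b₁ a₂ b₂ a₃ b₃

ε e₁ e₂ e₃ : ℤ₂³
ε  = false , false , false
e₁ = true  , false , false
e₂ = false , true  , false
e₃ = false , false , true

private
  componentwise : ∀ {a₁ a₂ a₃ b₁ b₂ b₃ : Bool} →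
    a₁ ≡ b₁ → a₂ ≡ b₂ → a₃ ≡ b₃ → (a₁ , a₂ , a₃) ≡ (b₁ , b₂ , b₃)
  componentwise eq₁ eq₂ eq₃ = cong₂ _,_ eq₁ (cong₂ _,_ eq₂ eq₃)

  xor-cancelˡ : ∀ a b → a xor (a xor b) ≡ b
  xor-cancelˡ a b = ≡.trans (≡.sym (xor-assoc a a b)) (cong (_xor b) (xor-same a))

  xor-cancelʳ : ∀ a b → (a xor b) xor b ≡ a
  xor-cancelʳ a b = ≡.trans (xor-assoc a b b) (≡.trans (cong (a xor_) (xor-same b)) (xor-identityʳ a))

⊕-comm : ∀ a b → a ⊕ b ≡ b ⊕ a
⊕-comm (a₁ , a₂ , a₃) (b₁ , b₂ , b₃) =
  componentwise (xor-comm a₁ b₁) (xor-comm a₂ b₂) (xor-comm a₃ b₃)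

⊕-cancelˡ : ∀ a b → a ⊕ (a ⊕ b) ≡ b
⊕-cancelˡ (a₁ , a₂ , a₃) (b₁ , b₂ , b₃) =
  componentwise (xor-cancelˡ a₁ b₁) (xor-cancelˡ a₂ b₂) (xor-cancelˡ a₃ b₃)

⊕-cancelʳ : ∀ a b → (a ⊕ b) ⊕ b ≡ a
⊕-cancelʳ (a₁ , a₂ , a₃) (b₁ , b₂ , b₃) =
  componentwise (xor-cancelʳ a₁ b₁) (xor-cancelʳ a₂ b₂) (xor-cancelʳ a₃ b₃)

⊕-assoc : ∀ a b c → (a ⊕ b) ⊕ c ≡ a ⊕ (b ⊕ c)
⊕-assoc (a₁ , a₂ , a₃) (b₁ , b₂ , b₃) (c₁ , c₂ , c₃) =
  componentwise (xor-assoc a₁ b₁ c₁) (xor-assoc a₂ b₂ c₂) (xor-assoc a₃ b₃ c₃)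

x⊕[y⊕x]≡y : ∀ a b → a ⊕ (b ⊕ a) ≡ b
x⊕[y⊕x]≡y a b = ≡.trans (⊕-comm a (b ⊕ a)) (⊕-cancelʳ b a)

[x⊕y]⊕x≡y : ∀ a b → (a ⊕ b) ⊕ a ≡ b
[x⊕y]⊕x≡y a b = ≡.trans (cong (_⊕ a) (⊕-comm a b)) (⊕-cancelʳ b a)

[x⊕y]⊕[x⊕z]≡y⊕z : ∀ a b c → (a ⊕ b) ⊕ (a ⊕ c) ≡ b ⊕ c
[x⊕y]⊕[x⊕z]≡y⊕z a b c = begin
  (a ⊕ b) ⊕ (a ⊕ c)   ≡⟨ cong (_⊕ (a ⊕ c)) (⊕-comm a b) ⟩
  (b ⊕ a) ⊕ (a ⊕ c)   ≡⟨ ⊕-assoc b a (a ⊕ c) ⟩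
  b ⊕ (a ⊕ (a ⊕ c))   ≡⟨ cong (b ⊕_) (⊕-cancelˡ a c) ⟩
  b ⊕ c               ∎
  where open ≡.≡-Reasoning

≢⊕e₁ : ∀ a → a ≢ a ⊕ e₁
≢⊕e₁ (true  , _) ()
≢⊕e₁ (false , _) ()

module Net {c ℓ} (K : Field c ℓ) (N : ProjectivePlane.Realizes3Net K ℤ₂³ _⊕_) where
  open Field K hiding (zero)
  open FieldGeometry K
  module P = ProjectivePlane K
  open P.Realizes3Net N
  open import Algebra.Properties.Group +-group using (x∙y⁻¹≈ε⇒x≈y)
  open RawMonad (¬¬-Monad {ℓ})

  toV : P.Triple → V
  toV t = v (P.x t) (P.y t) (P.z t)

  line : Fin 3 → ℤ₂³ → V
  line i g = toV (P.coords (φ i g))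

  A B C : ℤ₂³ → V
  A = line zero
  B = line (suc zero)
  C = line (suc (suc zero))

  line-nonzero : ∀ i g → NonZero (line i g)
  line-nonzero i g = P.nonzero (φ i g)

  cross-nonzero : ∀ i j → i ≢ j → ∀ a b → NonZero (cross (line i a) (line j b))
  cross-nonzero i j i≢j a b (x≈0 , y≈0 , z≈0) =
    classes-disjoint i j i≢j a b
      (x∙y⁻¹≈ε⇒x≈y _ _ x≈0 , x∙y⁻¹≈ε⇒x≈y _ _ y≈0 , x∙y⁻¹≈ε⇒x≈y _ _ z≈0)

  A∩B-on-C : ∀ a b g → a ⊕ b ≡ g → dot (cross (A a) (B b)) (C g) ≈ 0#
  A∩B-on-C a b _ ≡.refl = realizes a b A∩B (dot-crossˡ (A a) (B b)) (dot-crossʳ (A a) (B b))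
    where
    w : V
    w = cross (A a) (B b)
    A∩B : P.Point
    A∩B = P.proj P.⟨ x w , y w , z w ⟩ (cross-nonzero zero (suc zero) (λ ()) a b)

  same-class-nonconcurrent : ∀ i j → j ≢ i → ∀ b a a′ → a ≢ a′ →
    ¬ det (line j b) (line i a) (line i a′) ≈ 0#
  same-class-nonconcurrent i j j≢i b a a′ a≢a′ det≈0
    with net-i j i j≢i b a
  ... | X , X∈𝒳 , X-on-jb , X-on-ia =
    det≈0⇒on (toV (P.coords X)) (cross-nonzero j i j≢i b a) X-on-jb X-on-ia det≈0
      λ X-on-ia′ → a≢a′ (net-ii-unique X X∈𝒳 i a a′ X-on-ia X-on-ia′)

  α β : ℤ₂³ → Carrier
  α g = det (A ε) (B g) (B (g ⊕ e₁))
  β g = det (A e₁) (B g) (B (g ⊕ e₁))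

  B-pair-nonconcurrent : ∀ g h h′ → h ≢ h′ → ¬ det (A g) (B h) (B h′) ≈ 0#
  B-pair-nonconcurrent = same-class-nonconcurrent (suc zero) zero (λ ())

  α≉0 : ∀ g → ¬ α g ≈ 0#
  α≉0 g = B-pair-nonconcurrent ε g (g ⊕ e₁) (≢⊕e₁ g)

  β≉0 : ∀ g → ¬ β g ≈ 0#
  β≉0 g = B-pair-nonconcurrent e₁ g (g ⊕ e₁) (≢⊕e₁ g)

  harmonic : ∀ p q → p ≢ q → p ⊕ e₁ ≢ q → ¬ ¬ Harmonic (α p) (β p) (α q) (β q)
  harmonic p q p≢q p⊕e₁≢q = do
    on-Cp  ← on-line⇒det≈0 (C p) (line-nonzero _ p)
               (A∩B-on-C ε p p ≡.refl) (A∩B-on-C e₁ (p ⊕ e₁) p (x⊕[y⊕x]≡y e₁ p))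
               (A∩B-on-C r q p (⊕-cancelʳ p q))
    on-Cq  ← on-line⇒det≈0 (C q) (line-nonzero _ q)
               (A∩B-on-C ε q q ≡.refl) (A∩B-on-C e₁ (q ⊕ e₁) q (x⊕[y⊕x]≡y e₁ q))
               (A∩B-on-C r p q ([x⊕y]⊕x≡y p q))
    on-Cq′ ← on-line⇒det≈0 (C (q ⊕ e₁)) (line-nonzero _ (q ⊕ e₁))
               (A∩B-on-C ε (q ⊕ e₁) (q ⊕ e₁) ≡.refl) (A∩B-on-C e₁ q (q ⊕ e₁) (⊕-comm e₁ q))
               (A∩B-on-C r (p ⊕ e₁) (q ⊕ e₁) ([x⊕y]⊕[x⊕z]≡y⊕z p q e₁))
    on-Ar  ← on-line⇒det≈0 (A r) (line-nonzero _ r)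
               (through-meet q on-Cp) (through-meet p on-Cq) (through-meet (p ⊕ e₁) on-Cq′)
    pure (*≈0-cancelˡ (*-≉0 (*-≉0 F₁≉0 F₂≉0) F₃≉0)
           (trans (sym (det-meets (A ε) (A e₁) (B p) (B (p ⊕ e₁)) (B q) (B (q ⊕ e₁)))) on-Ar))
    where
    r : ℤ₂³
    r = p ⊕ q
    through-meet : ∀ {s t} g → det s t (cross (A r) (B g)) ≈ 0# → dot (meet s t (B g)) (A r) ≈ 0#
    through-meet {s} {t} g det≈0 = trans (sym (det-cross≈dot-meet s t (A r) (B g))) det≈0
    F₁≉0 : ¬ det (A ε) (B p) (B q) ≈ 0#
    F₁≉0 = B-pair-nonconcurrent ε p q p≢q
    F₂≉0 : ¬ det (A e₁) (A ε) (B (q ⊕ e₁)) ≈ 0#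
    F₂≉0 det≈0 = same-class-nonconcurrent zero (suc zero) (λ ()) (q ⊕ e₁) e₁ ε (λ ())
                   (trans (sym (det-rotate (A e₁) (A ε) (B (q ⊕ e₁)))) det≈0)
    F₃≉0 : ¬ det (A e₁) (B (p ⊕ e₁)) (B q) ≈ 0#
    F₃≉0 = B-pair-nonconcurrent e₁ (p ⊕ e₁) q p⊕e₁≢q

  no-realization : ¬ fromℕ 2 ≈ 0# → ⊥
  no-realization 2≉0 =
    harmonic ε e₂ (λ ()) (λ ()) λ h₁₂ →
    harmonic ε e₃ (λ ()) (λ ()) λ h₁₃ →
    harmonic e₂ e₃ (λ ()) (λ ()) λ h₂₃ →
    no-three-harmonic 2≉0 (β≉0 ε) (α≉0 e₂) (β≉0 e₃) h₁₂ h₁₃ h₂₃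

theorem4p2 : ∀ {c ℓ} (K : Field c ℓ) → CharZero K → AlgClosed K →
    ¬ ProjectivePlane.Realizes3Net K ℤ₂³ _⊕_
theorem4p2 K char0 _ N = Net.no-realization K N (char0 1)
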